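{- For every graph $G$ and every 2-switch $\tau$ on $G$, $|\pi(\tau(G))-\pi(G)|\le 1$, where $\pi$ denotes the path-covering number.
   Context: Graphs are finite and simple. A 2-switch on $G$ is specified by four distinct vertices $a,b,c,d$ with $ab,cd\in E(G)$ and $ac,bd\notin E(G)$; it produces $\tau(G)=G-ab-cd+ac+bd$. A path covering of $G$ is a set of pairwise vertex-disjoint paths in $G$ (single vertices allowed) covering all vertices of $G$; $\pi(G)$ is the minimum number of paths in a path covering of $G$. -}

module Defs where

open import Data.Nat using (ℕ; suc; _≤_)
open import Data.Bool using (Bool; true; false; if_then_else_; _∧_; _∨_)
open import Data.Fin using (Fin; _≟_)
open import Data.Fin.Base using ()
open import Data.List using (List; []; _∷_; length; concat; map; allFin)
open import Data.List.Relation.Unary.Unique.Propositional using (Unique)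
open import Data.List.Relation.Binary.Permutation.Propositional using (_↭_)
import Data.List.Relation.Unary.All
open import Data.Product using (_×_; Σ)
open import Relation.Nullary using (¬_)
open import Relation.Nullary.Decidable using (⌊_⌋)
open import Relation.Binary.PropositionalEquality using (_≡_; _≢_)

Adj : ℕ → Set
Adj n = Fin n → Fin n → Bool

E : ∀ {n} → Adj n → Fin n → Fin n → Set
E G u v = G u v ≡ true

record IsSimpleGraph {n : ℕ} (G : Adj n) : Set where
  field
    symmetric  : ∀ u v → G u v ≡ G v u
    irreflexive : ∀ u → G u u ≡ false

record IsTwoSwitch {n : ℕ} (G : Adj n) (a b c d : Fin n) : Set where
  field
    a≢b : a ≢ b
    a≢c : a ≢ c
    a≢d : a ≢ d
    b≢c : b ≢ c
    b≢d : b ≢ d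
    c≢d : c ≢ d
    ab∈E : E G a b
    cd∈E : E G c d
    ac∉E : ¬ E G a c
    bd∉E : ¬ E G b d

samePair : ∀ {n} → Fin n → Fin n → Fin n → Fin n → Bool
samePair u v x y = (⌊ u ≟ x ⌋ ∧ ⌊ v ≟ y ⌋) ∨ (⌊ u ≟ y ⌋ ∧ ⌊ v ≟ x ⌋)

twoSwitch : ∀ {n} → Adj n → Fin n → Fin n → Fin n → Fin n → Adj n
twoSwitch G a b c d u v =
  if samePair u v a b ∨ samePair u v c d then false
  else if samePair u v a c ∨ samePair u v b d then true
  else G u v

data Walk {n : ℕ} (G : Adj n) : List (Fin n) → Set where
  single : ∀ v → Walk G (v ∷ [])
  step   : ∀ {u v vs} → E G u v → Walk G (v ∷ vs) → Walk G (u ∷ v ∷ vs)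

IsPath : ∀ {n} → Adj n → List (Fin n) → Set
IsPath G p = Walk G p × Unique p

-- a path covering: paths that are pairwise vertex-disjoint and together cover
-- every vertex, i.e. the concatenated vertex lists are a permutation of all vertices
record PathCovering {n : ℕ} (G : Adj n) : Set where
  field
    paths   : List (List (Fin n))
    arePaths : Data.List.Relation.Unary.All.All (IsPath G) paths
    partition : concat paths ↭ allFin n

IsPathCoverNumber : ∀ {n} → Adj n → ℕ → Set
IsPathCoverNumber G k =
  Σ (PathCovering G) (λ P → length (PathCovering.paths P) ≡ k)
  × (∀ (P : PathCovering G) → k ≤ length (PathCovering.paths P))

module Submission where

-- Cut the edges ab and cd out of a path cover of G by k paths. If at most one of them was used,
-- at most k + 1 paths of τ(G) remain. If both were used, k + 2 paths remain, in which a and b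
-- end different paths and so do c and d. If the cd-path was not a's path, a still ends its path,
-- which joins the c-piece along the new edge ac. Otherwise a ends the c-piece, and the d-piece
-- joins b's path along bd, or a ends the d-piece, which joins the c-piece along ac. Either way
-- k + 1 paths remain. Since the 2-switch on a c b d turns τ(G) back into G, the same argument
-- bounds π(G) by π(τ(G)) + 1.

open import Defs
open import Data.Nat using (ℕ; suc; _≤_)
open import Data.Fin using (Fin)
open import Data.Product using (_×_)

open import Level using (0ℓ)
open import Function using (_∘_)
open import Data.Nat using (z≤n; s≤s)
open import Data.Nat.Properties using (≤-refl; ≤-reflexive; ≤-trans; n≤1+n; m≤n⇒m≤1+n; suc-injective)
open import Data.Bool using (true; false; _∧_; _∨_; if_then_else_)
open import Data.Bool.Properties using (∧-comm; ∨-comm)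
import Data.Fin as Fin
open import Data.List using (List; []; _∷_; _++_; [_]; _∷ʳ_; _ʳ++_; concat; length; reverse; allFin)
open import Data.List.Properties using (++-assoc; ∷-injectiveˡ; ∷-injectiveʳ; ++-conicalʳ; reverse-++; ʳ++-defn)
open import Data.List.Membership.Propositional using (_∈_; _∉_)
open import Data.List.Membership.Propositional.Properties using (∈-++⁺ˡ; ∈-++⁺ʳ; ∈-concat⁺′)
open import Data.List.Relation.Unary.All as All using (All; []; _∷_)
import Data.List.Relation.Unary.All.Properties as All
open import Data.List.Relation.Unary.Any using (here; there)
open import Data.List.Relation.Unary.AllPairs using ([]; _∷_)
open import Data.List.Relation.Unary.Linked as Linked using (Linked; []; [-]; _∷_)
open import Data.List.Relation.Unary.Unique.Propositional using (Unique)
open import Data.List.Relation.Unary.Unique.Propositional.Properties using (allFin⁺)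
open import Data.List.Relation.Binary.Disjoint.Propositional using (Disjoint)
open import Data.List.Relation.Binary.Permutation.Propositional
  using (_↭_; refl; prep; swap; trans; ↭-refl; ↭-sym; ↭-trans; ↭⇒↭ₛ; module PermutationReasoning)
open import Data.List.Relation.Binary.Permutation.Propositional.Properties
  using (All-resp-↭; ++⁺ˡ; ++⁺ʳ; ++⁺; shift; shifts; ↭-length; ↭-reverse)
import Data.List.Relation.Binary.Permutation.Setoid.Properties as Permutationₛ
open import Data.Product using (Σ-syntax; ∃-syntax; _,_; proj₁; map₁)
open import Data.Sum as Sum using (_⊎_; inj₁; inj₂)
open import Relation.Binary using (Rel; Symmetric; DecidableEquality; _⇒_)
open import Relation.Binary.PropositionalEquality
  using (_≡_; _≢_; refl; sym; cong; cong₂; subst; setoid; ≢-sym)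
  renaming (trans to ≡-trans)
open import Relation.Nullary using (¬_; Dec; yes; no; does; _×-dec_; _⊎-dec_)
open import Relation.Nullary.Decidable using (⌊_⌋; isYes≗does; dec-true; dec-false)
open import Relation.Unary using (Pred)

module _ {A : Set} where

  concat-↭ : {Ps Qs : List (List A)} → Ps ↭ Qs → concat Ps ↭ concat Qs
  concat-↭ refl         = ↭-refl
  concat-↭ (prep P p)   = ++⁺ˡ P (concat-↭ p)
  concat-↭ (swap P Q p) = ↭-trans (++⁺ˡ P (++⁺ˡ Q (concat-↭ p))) (shifts P Q)
  concat-↭ (trans p q)  = ↭-trans (concat-↭ p) (concat-↭ q)

  Unique-resp-↭ : {xs ys : List A} → xs ↭ ys → Unique xs → Unique ys
  Unique-resp-↭ p = Permutationₛ.Unique-resp-↭ (setoid A) (↭⇒↭ₛ p)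

  Unique-++⁻ : ∀ xs {ys : List A} → Unique (xs ++ ys) → Unique xs × Unique ys × Disjoint xs ys
  Unique-++⁻ []       u          = [] , u , λ { (() , _) }
  Unique-++⁻ (x ∷ xs) (x∉ ∷ u) with Unique-++⁻ xs u
  ... | u-xs , u-ys , xs#ys = All.++⁻ˡ xs x∉ ∷ u-xs , u-ys , λ where
    (here refl   , v∈ys) → All.lookup (All.++⁻ʳ xs x∉) v∈ys refl
    (there v∈xs , v∈ys) → xs#ys (v∈xs , v∈ys)

  all-or-split : {P Q : Pred A 0ℓ} → (∀ x → P x ⊎ Q x) → ∀ xs →
                 All P xs ⊎ ∃[ ys ] ∃[ x ] ∃[ zs ] xs ≡ ys ++ x ∷ zs × Q x
  all-or-split f [] = inj₁ []
  all-or-split f (x ∷ xs) with f x | all-or-split f xs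
  ... | inj₂ qx | _                           = inj₂ ([] , x , xs , refl , qx)
  ... | inj₁ px | inj₁ pxs                    = inj₁ (px ∷ pxs)
  ... | inj₁ px | inj₂ (ys , y , zs , refl , qy) = inj₂ (x ∷ ys , y , zs , refl , qy)

  End : A → List A → Set
  End v P = (∃[ P′ ] P ≡ v ∷ P′) ⊎ (∃[ P′ ] P ≡ P′ ∷ʳ v)

  End-++⁻ : ∀ U {s t V} {v : A} → End v ((U ∷ʳ s) ++ t ∷ V) → End v (U ∷ʳ s) ⊎ End v (t ∷ V)
  End-++⁻ []      (inj₁ (_ , refl)) = inj₁ (inj₁ ([] , refl))
  End-++⁻ (u ∷ U) (inj₁ (_ , refl)) = inj₁ (inj₁ (_ , refl))
  End-++⁻ U {s}   (inj₂ (P′ , eq))  = inj₂ (inj₂ (last-of-suffix (U ∷ʳ s) P′ eq))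
    where
      last-of-suffix : ∀ W {t V v} (P′ : List A) → W ++ t ∷ V ≡ P′ ∷ʳ v → ∃[ Q ] t ∷ V ≡ Q ∷ʳ v
      last-of-suffix []      P′       eq = P′ , eq
      last-of-suffix (w ∷ W) []       eq with ++-conicalʳ W _ (∷-injectiveʳ eq)
      ... | ()
      last-of-suffix (w ∷ W) (p ∷ P′) eq = last-of-suffix W P′ (∷-injectiveʳ eq)

module _ {A : Set} {R : Rel A 0ℓ} where

  All⇒Linked : {P : Pred A 0ℓ} → (∀ {u v} → P u → P v → R u v) → ∀ {xs} → All P xs → Linked R xs
  All⇒Linked f []           = []
  All⇒Linked f (p ∷ [])     = [-]
  All⇒Linked f (p ∷ q ∷ ps) = f p q ∷ All⇒Linked f (q ∷ ps)

  Linked-++⁻ : ∀ xs {ys} → Linked R (xs ++ ys) → Linked R xs × Linked R ys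
  Linked-++⁻ []           l       = [] , l
  Linked-++⁻ (x ∷ [])     l       = [-] , Linked.tail l
  Linked-++⁻ (x ∷ y ∷ xs) (r ∷ l) = map₁ (r ∷_) (Linked-++⁻ (y ∷ xs) l)

  module _ (R-sym : Symmetric R) where

    ʳ++⁺ : ∀ {x xs y ys} → Linked R (x ∷ xs) → R x y → Linked R (y ∷ ys) →
           Linked R ((x ∷ xs) ʳ++ (y ∷ ys))
    ʳ++⁺ [-]       xy l = xy ∷ l
    ʳ++⁺ (xz ∷ l′) xy l = ʳ++⁺ l′ (R-sym xz) (xy ∷ l)

    reverse⁺ : ∀ {xs} → Linked R xs → Linked R (reverse xs)
    reverse⁺ []       = []
    reverse⁺ [-]      = [-]
    reverse⁺ (xy ∷ l) = ʳ++⁺ l (R-sym xy) [-]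

    start-at-end : ∀ {v P} → End v P → Linked R P → ∃[ P′ ] Linked R (v ∷ P′) × v ∷ P′ ↭ P
    start-at-end     (inj₁ (P′ , refl)) l = P′ , l , ↭-refl
    start-at-end {v} (inj₂ (P′ , refl)) l =
      reverse P′ ,
      subst (Linked R) (reverse-++ P′ [ v ]) (reverse⁺ l) ,
      subst (_↭ P′ ∷ʳ v) (reverse-++ P′ [ v ]) (↭-reverse (P′ ∷ʳ v))

    join : ∀ {x y P Q} → R x y → End x P → End y Q → Linked R P → Linked R Q →
           ∃[ J ] Linked R J × J ↭ P ++ Q
    join {x} {y} {P} {Q} xy x-end y-end lP lQ
      with start-at-end x-end lP | start-at-end y-end lQ
    ... | P′ , lP′ , P′↭P | Q′ , lQ′ , Q′↭Q =
      (x ∷ P′) ʳ++ (y ∷ Q′) , ʳ++⁺ lP′ xy lQ′ , (begin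
        (x ∷ P′) ʳ++ (y ∷ Q′)      ≡⟨ ʳ++-defn (x ∷ P′) ⟩
        reverse (x ∷ P′) ++ y ∷ Q′ ↭⟨ ++⁺ʳ (y ∷ Q′) (↭-reverse (x ∷ P′)) ⟩
        (x ∷ P′) ++ y ∷ Q′         ↭⟨ ++⁺ P′↭P Q′↭Q ⟩
        P ++ Q                     ∎)
      where open PermutationReasoning

module _ {A : Set} where

  SameEdge : A → A → A → A → Set
  SameEdge u v x y = (u ≡ x × v ≡ y) ⊎ (u ≡ y × v ≡ x)

  RemoveEdge : Rel A 0ℓ → A → A → Rel A 0ℓ
  RemoveEdge R x y u v = R u v × ¬ SameEdge u v x y

  RemoveEdge-comm : ∀ {R x y} → RemoveEdge R y x ⇒ RemoveEdge R x y
  RemoveEdge-comm (r , ¬yx) = r , ¬yx ∘ Sum.swap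

  absent⇒RemoveEdge : ∀ {R x y P} → x ∉ P ⊎ y ∉ P → Linked R P → Linked (RemoveEdge R x y) P
  absent⇒RemoveEdge {P = P} (inj₁ x∉P) l = Linked.zip (l , All⇒Linked not-x (All.¬Any⇒All¬ P x∉P))
    where
      not-x : ∀ {x y u v} → ¬ x ≡ u → ¬ x ≡ v → ¬ SameEdge u v x y
      not-x x≢u x≢v (inj₁ (u≡x , _)) = x≢u (sym u≡x)
      not-x x≢u x≢v (inj₂ (_ , v≡x)) = x≢v (sym v≡x)
  absent⇒RemoveEdge {P = P} (inj₂ y∉P) l = Linked.zip (l , All⇒Linked not-y (All.¬Any⇒All¬ P y∉P))
    where
      not-y : ∀ {x y u v} → ¬ y ≡ u → ¬ y ≡ v → ¬ SameEdge u v x y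
      not-y y≢u y≢v (inj₁ (_ , v≡y)) = y≢v (sym v≡y)
      not-y y≢u y≢v (inj₂ (u≡y , _)) = y≢u (sym u≡y)

  Avoids : A → A → List A → Set
  Avoids x y = Linked (λ u v → ¬ SameEdge u v x y)

  Crosses : A → A → List A → Set
  Crosses x y P = ∃[ U ] ∃[ W ] P ≡ (U ∷ʳ x) ++ y ∷ W

  module _ (_≟_ : DecidableEquality A) where

    sameEdge? : ∀ u v x y → Dec (SameEdge u v x y)
    sameEdge? u v x y = (u ≟ x ×-dec v ≟ y) ⊎-dec (u ≟ y ×-dec v ≟ x)

    avoids-or-crosses : ∀ x y P → Avoids x y P ⊎ Crosses x y P ⊎ Crosses y x P
    avoids-or-crosses x y []      = inj₁ []
    avoids-or-crosses x y (u ∷ []) = inj₁ [-]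
    avoids-or-crosses x y (u ∷ v ∷ P) with sameEdge? u v x y | avoids-or-crosses x y (v ∷ P)
    ... | yes (inj₁ (refl , refl)) | _             = inj₂ (inj₁ ([] , P , refl))
    ... | yes (inj₂ (refl , refl)) | _             = inj₂ (inj₂ ([] , P , refl))
    ... | no ¬uv                   | inj₁ avoids   = inj₁ (¬uv ∷ avoids)
    ... | no ¬uv                   | inj₂ crossing = inj₂ (Sum.map (Crosses-∷ u) (Crosses-∷ u) crossing)
      where
        Crosses-∷ : ∀ {x y Q} u → Crosses x y Q → Crosses x y (u ∷ Q)
        Crosses-∷ u (U , W , eq) = u ∷ U , W , cong (u ∷_) eq

module Covering {A : Set} (_≟_ : DecidableEquality A) (V : List A) (V-unique : Unique V) where

  record Cover (R : Rel A 0ℓ) (Ps : List (List A)) : Set where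
    field
      walks     : All (Linked R) Ps
      partition : concat Ps ↭ V

    unique : Unique (concat Ps)
    unique = Unique-resp-↭ (↭-sym partition) V-unique

  open Cover

  CoverWithin : Rel A 0ℓ → ℕ → Set
  CoverWithin R k = Σ[ Ps ∈ List (List A) ] Cover R Ps × length Ps ≤ k

  module _ {R : Rel A 0ℓ} where

    Cover-mono : ∀ {S Ps} → R ⇒ S → Cover R Ps → Cover S Ps
    Cover-mono R⇒S cov = record { walks = All.map (Linked.map R⇒S) (walks cov) ; partition = partition cov }

    Cover-resp-↭ : ∀ {Ps Qs} → Ps ↭ Qs → Cover R Ps → Cover R Qs
    Cover-resp-↭ p cov = record
      { walks     = All-resp-↭ p (walks cov)
      ; partition = ↭-trans (concat-↭ (↭-sym p)) (partition cov)
      }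

    join-cover : Symmetric R → ∀ {x y P Q Ps Rs} → R x y → End x P → End y Q →
                 Cover R Ps → Ps ↭ P ∷ Q ∷ Rs → Σ[ Qs ∈ List (List A) ] Cover R Qs × suc (length Qs) ≡ length Ps
    join-cover R-sym {P = P} {Q} {Rs = Rs} xy x-end y-end cov p
      with walks (Cover-resp-↭ p cov) | partition (Cover-resp-↭ p cov)
    ... | lP ∷ lQ ∷ lRs | P++Q++Rs↭V with join R-sym xy x-end y-end lP lQ
    ...   | J , lJ , J↭P++Q =
      J ∷ Rs , record { walks = lJ ∷ lRs ; partition = J++Rs↭V } , sym (↭-length p)
      where
        open PermutationReasoning
        J++Rs↭V : J ++ concat Rs ↭ V
        J++Rs↭V = begin
          J ++ concat Rs       ↭⟨ ++⁺ʳ (concat Rs) J↭P++Q ⟩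
          (P ++ Q) ++ concat Rs ≡⟨ ++-assoc P Q (concat Rs) ⟩
          P ++ Q ++ concat Rs   ↭⟨ P++Q++Rs↭V ⟩
          V                     ∎

  cut-path : ∀ {R x y S₁ S₂ Rs} → x ∈ S₁ → y ∈ S₂ →
             Cover R ((S₁ ++ S₂) ∷ Rs) → Cover (RemoveEdge R x y) (S₁ ∷ S₂ ∷ Rs)
  cut-path {R} {x} {y} {S₁} {S₂} {Rs} x∈S₁ y∈S₂ cov =
    let l₁ , l₂          = Linked-++⁻ S₁ (All.head (walks cov))
        u₁₂ , _ , S₁₂#Rs = Unique-++⁻ (S₁ ++ S₂) (unique cov)
        _ , _ , S₁#S₂    = Unique-++⁻ S₁ u₁₂
        x∉Rs : ∀ {Q} → Q ∈ Rs → x ∉ Q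
        x∉Rs Q∈Rs x∈Q = S₁₂#Rs (∈-++⁺ˡ x∈S₁ , ∈-concat⁺′ x∈Q Q∈Rs)
    in record
      { walks     = absent⇒RemoveEdge (inj₂ λ y∈S₁ → S₁#S₂ (y∈S₁ , y∈S₂)) l₁
                  ∷ absent⇒RemoveEdge (inj₁ λ x∈S₂ → S₁#S₂ (x∈S₁ , x∈S₂)) l₂
                  ∷ All.tabulate (λ Q∈Rs → absent⇒RemoveEdge (inj₁ (x∉Rs Q∈Rs))
                                                               (All.lookup (All.tail (walks cov)) Q∈Rs))
      ; partition = subst (_↭ V) (++-assoc S₁ S₂ (concat Rs)) (partition cov)
      }

  record EdgeCut (R : Rel A 0ℓ) (x y : A) (Ps : List (List A)) : Set where
    field
      before after        : List (List A)
      path xPiece yPiece  : List A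
      position            : Ps ≡ before ++ path ∷ after
      x-end               : End x xPiece
      y-end               : End y yPiece
      ends-kept           : ∀ {v} → End v path → End v xPiece ⊎ End v yPiece
      pieces              : Cover (RemoveEdge R x y) (xPiece ∷ yPiece ∷ before ++ after)

    pieces-length : length (xPiece ∷ yPiece ∷ before ++ after) ≡ suc (length Ps)
    pieces-length = cong suc (sym (≡-trans (cong length position) (↭-length (shift path before after))))

  cut-crossing : ∀ {R x y} L {P} M → Crosses x y P ⊎ Crosses y x P →
                 Cover R (P ∷ L ++ M) → EdgeCut R x y (L ++ P ∷ M)
  cut-crossing L M (inj₁ (U , W , refl)) cov = record
    { before = L ; after = M ; position = refl
    ; x-end = inj₂ (U , refl) ; y-end = inj₁ (W , refl)
    ; ends-kept = End-++⁻ U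
    ; pieces = cut-path (∈-++⁺ʳ U (here refl)) (here refl) cov
    }
  cut-crossing {R} L M (inj₂ (U , W , refl)) cov = record
    { before = L ; after = M ; position = refl
    ; x-end = inj₁ (W , refl) ; y-end = inj₂ (U , refl)
    ; ends-kept = Sum.swap ∘ End-++⁻ U
    ; pieces = Cover-resp-↭ (swap _ _ ↭-refl)
                 (Cover-mono (RemoveEdge-comm {R = R}) (cut-path (∈-++⁺ʳ U (here refl)) (here refl) cov))
    }

  cut-edge : ∀ {R} x y {Ps} → Cover R Ps → Cover (RemoveEdge R x y) Ps ⊎ EdgeCut R x y Ps
  cut-edge x y {Ps} cov with all-or-split (avoids-or-crosses _≟_ x y) Ps
  ... | inj₁ avoiding = inj₁ record
    { walks = All.zipWith Linked.zip (walks cov , avoiding) ; partition = partition cov }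
  ... | inj₂ (L , P , M , refl , crossing) =
    inj₂ (cut-crossing L M crossing (Cover-resp-↭ (shift P L M) cov))

  module _ {R T : Rel A 0ℓ} (T-sym : Symmetric T) {a b c d : A}
           (kept : RemoveEdge (RemoveEdge R a b) c d ⇒ T) (ac : T a c) (bd : T b d) where

    private
      join-within : ∀ {x y P Q Ps Rs k} → T x y → End x P → End y Q →
                    Cover T Ps → Ps ↭ P ∷ Q ∷ Rs → length Ps ≡ suc k → CoverWithin T k
      join-within xy x-end y-end cov p len with join-cover T-sym xy x-end y-end cov p
      ... | Qs , cov′ , len′ = Qs , cov′ , ≤-reflexive (suc-injective (≡-trans len′ len))

    rejoin-cut : ∀ {Pa Pb Rs} → End a Pa → End b Pb → EdgeCut (RemoveEdge R a b) c d (Pa ∷ Pb ∷ Rs) →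
                 CoverWithin T (length (Pa ∷ Pb ∷ Rs))
    rejoin-cut {Pb = Pb} {Rs} a-end b-end ec@record { before = [] ; position = refl }
      with EdgeCut.ends-kept ec a-end
    ... | inj₁ _ = join-within (T-sym bd) y-end b-end (Cover-mono kept pieces)
                     (↭-sym (shift xPiece (yPiece ∷ Pb ∷ []) Rs)) pieces-length
      where open EdgeCut ec
    ... | inj₂ a-ends-d-piece = join-within ac a-ends-d-piece x-end (Cover-mono kept pieces)
                                  (swap _ _ ↭-refl) pieces-length
      where open EdgeCut ec
    rejoin-cut a-end _ ec@record { before = K ∷ _ } =
      join-within ac (subst (End a) (∷-injectiveˡ position) a-end) x-end (Cover-mono kept pieces)
        (shift K (xPiece ∷ yPiece ∷ []) _) pieces-length
      where open EdgeCut ec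

    rejoin : ∀ {Pa Pb Rs} → Cover (RemoveEdge R a b) (Pa ∷ Pb ∷ Rs) → End a Pa → End b Pb →
             CoverWithin T (length (Pa ∷ Pb ∷ Rs))
    rejoin cov a-end b-end with cut-edge c d cov
    ... | inj₁ cov′ = _ , Cover-mono kept cov′ , ≤-refl
    ... | inj₂ ec   = rejoin-cut a-end b-end ec

    switch-cover : ∀ {Ps} → Cover R Ps → CoverWithin T (suc (length Ps))
    switch-cover cov with cut-edge a b cov
    ... | inj₂ ec = subst (CoverWithin T) pieces-length (rejoin pieces x-end y-end)
      where open EdgeCut ec
    ... | inj₁ cov′ with cut-edge c d cov′
    ...   | inj₁ cov″ = _ , Cover-mono kept cov″ , n≤1+n _
    ...   | inj₂ ec   = _ , Cover-mono kept pieces , ≤-reflexive pieces-length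
      where open EdgeCut ec

module _ {n : ℕ} where

  open Covering (Fin._≟_ {n}) (allFin n) (allFin⁺ n)
  open Cover

  samePair≡does : ∀ (u v x y : Fin n) → samePair u v x y ≡ does (sameEdge? Fin._≟_ u v x y)
  samePair≡does u v x y =
    cong₂ _∨_ (cong₂ _∧_ (isYes≗does (u Fin.≟ x)) (isYes≗does (v Fin.≟ y)))
              (cong₂ _∧_ (isYes≗does (u Fin.≟ y)) (isYes≗does (v Fin.≟ x)))

  samePair-false : ∀ {u v x y : Fin n} → ¬ SameEdge u v x y → samePair u v x y ≡ false
  samePair-false {u} {v} {x} {y} ¬uv = ≡-trans (samePair≡does u v x y) (dec-false (sameEdge? Fin._≟_ u v x y) ¬uv)

  samePair-refl : ∀ (x y : Fin n) → samePair x y x y ≡ true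
  samePair-refl x y = ≡-trans (samePair≡does x y x y) (dec-true (sameEdge? Fin._≟_ x y x y) (inj₁ (refl , refl)))

  samePair-comm : ∀ (u v x y : Fin n) → samePair u v x y ≡ samePair v u x y
  samePair-comm u v x y =
    ≡-trans (∨-comm (⌊ u Fin.≟ x ⌋ ∧ ⌊ v Fin.≟ y ⌋) (⌊ u Fin.≟ y ⌋ ∧ ⌊ v Fin.≟ x ⌋))
            (cong₂ _∨_ (∧-comm ⌊ u Fin.≟ y ⌋ ⌊ v Fin.≟ x ⌋) (∧-comm ⌊ u Fin.≟ x ⌋ ⌊ v Fin.≟ y ⌋))

  ¬SameEdgeˡ : ∀ {u v x y : Fin n} → u ≢ x → u ≢ y → ¬ SameEdge u v x y
  ¬SameEdgeˡ u≢x u≢y (inj₁ (u≡x , _)) = u≢x u≡x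
  ¬SameEdgeˡ u≢x u≢y (inj₂ (u≡y , _)) = u≢y u≡y

  ¬SameEdgeʳ : ∀ {u v x y : Fin n} → v ≢ x → v ≢ y → ¬ SameEdge u v x y
  ¬SameEdgeʳ v≢x v≢y (inj₁ (_ , v≡y)) = v≢y v≡y
  ¬SameEdgeʳ v≢x v≢y (inj₂ (_ , v≡x)) = v≢x v≡x

  module _ {G : Adj n} (G-simple : IsSimpleGraph G) {a b c d : Fin n} (τ : IsTwoSwitch G a b c d) where

    open IsSimpleGraph G-simple
    open IsTwoSwitch τ

    E-sym : Symmetric (E G)
    E-sym {u} {v} uv = ≡-trans (symmetric v u) uv

    switch-comm : ∀ u v → twoSwitch G a b c d u v ≡ twoSwitch G a b c d v u
    switch-comm u v rewrite samePair-comm u v a b | samePair-comm u v c d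
                          | samePair-comm u v a c | samePair-comm u v b d | symmetric u v = refl

    switch-sym : Symmetric (E (twoSwitch G a b c d))
    switch-sym {u} {v} uv = ≡-trans (switch-comm v u) uv

    switch-keeps : RemoveEdge (RemoveEdge (E G) a b) c d ⇒ E (twoSwitch G a b c d)
    switch-keeps {u} {v} ((uv , ¬ab) , ¬cd) rewrite samePair-false ¬ab | samePair-false ¬cd
      with samePair u v a c ∨ samePair u v b d
    ... | true  = refl
    ... | false = uv

    switch-adds-ac : E (twoSwitch G a b c d) a c
    switch-adds-ac
      rewrite samePair-false (¬SameEdgeʳ {a} (≢-sym a≢c) (≢-sym b≢c))
            | samePair-false (¬SameEdgeˡ {v = c} a≢c a≢d) | samePair-refl a c = refl

    switch-adds-bd : E (twoSwitch G a b c d) b d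
    switch-adds-bd
      rewrite samePair-false (¬SameEdgeʳ {b} (≢-sym a≢d) (≢-sym b≢d))
            | samePair-false (¬SameEdgeˡ {v = d} b≢c b≢d)
            | samePair-false (¬SameEdgeˡ {v = d} (≢-sym a≢b) b≢c) | samePair-refl b d = refl

    switch-restores : RemoveEdge (RemoveEdge (E (twoSwitch G a b c d)) a c) b d ⇒ E G
    switch-restores {u} {v} ((uv , ¬ac) , ¬bd) =
      restore {samePair u v a b ∨ samePair u v c d} uv (cong₂ _∨_ (samePair-false ¬ac) (samePair-false ¬bd))
      where
        restore : ∀ {X Y g} → (if X then false else if Y then true else g) ≡ true → Y ≡ false → g ≡ true
        restore {false} uv refl = uv
        restore {true}  ()

    switch-covers : ∀ {Ps} → Cover (E G) Ps → CoverWithin (E (twoSwitch G a b c d)) (suc (length Ps))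
    -- eta-expanded because E (twoSwitch …) is not injective, so its implicit endpoints cannot be inferred
    switch-covers = switch-cover (λ {u v} → switch-sym {u} {v}) switch-keeps switch-adds-ac switch-adds-bd

    unswitch-covers : ∀ {Ps} → Cover (E (twoSwitch G a b c d)) Ps → CoverWithin (E G) (suc (length Ps))
    unswitch-covers = switch-cover {T = E G} E-sym switch-restores ab∈E cd∈E

  module _ {G : Adj n} where

    Walk⇒Linked : ∀ {xs} → Walk G xs → Linked (E G) xs
    Walk⇒Linked (single v) = [-]
    Walk⇒Linked (step e w) = e ∷ Walk⇒Linked w

    Linked⇒Walk : ∀ {x xs} → Linked (E G) (x ∷ xs) → Walk G (x ∷ xs)
    Linked⇒Walk [-]     = single _
    Linked⇒Walk (e ∷ l) = step e (Linked⇒Walk l)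

    toCover : (P : PathCovering G) → Cover (E G) (PathCovering.paths P)
    toCover P = record
      { walks     = All.map (Walk⇒Linked ∘ proj₁) (PathCovering.arePaths P)
      ; partition = PathCovering.partition P
      }

    drop-empty-walks : ∀ Qs → All (Linked (E G)) Qs → Unique (concat Qs) →
                     Σ[ Ps ∈ List (List (Fin n)) ] All (IsPath G) Ps × concat Ps ≡ concat Qs × length Ps ≤ length Qs
    drop-empty-walks []             []       _ = [] , [] , refl , z≤n
    drop-empty-walks ([] ∷ Qs)      (_ ∷ ls) u =
      let Ps , ps , eq , Ps≤Qs = drop-empty-walks Qs ls u in Ps , ps , eq , m≤n⇒m≤1+n Ps≤Qs
    drop-empty-walks ((v ∷ Q) ∷ Qs) (l ∷ ls) u =
      let u-Q , u-Qs , _ = Unique-++⁻ (v ∷ Q) u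
          Ps , ps , eq , Ps≤Qs = drop-empty-walks Qs ls u-Qs
      in (v ∷ Q) ∷ Ps , (Linked⇒Walk l , u-Q) ∷ ps , cong ((v ∷ Q) ++_) eq , s≤s Ps≤Qs

    fromCover : ∀ {Qs} → Cover (E G) Qs → Σ[ P ∈ PathCovering G ] length (PathCovering.paths P) ≤ length Qs
    fromCover {Qs} cov =
      let Ps , ps , eq , Ps≤Qs = drop-empty-walks Qs (walks cov) (unique cov)
      in record { paths = Ps ; arePaths = ps ; partition = subst (_↭ allFin n) (sym eq) (partition cov) } , Ps≤Qs

  pathCoverNumber-≤ : ∀ {G H : Adj n} {p q} →
                      (∀ {Ps} → Cover (E G) Ps → CoverWithin (E H) (suc (length Ps))) →
                      IsPathCoverNumber G p → IsPathCoverNumber H q → q ≤ suc p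
  pathCoverNumber-≤ transfer ((P , refl) , _) (_ , q-min) =
    let Qs , cov , Qs≤P = transfer (toCover P)
        Q , Q≤Qs = fromCover cov
    in ≤-trans (q-min Q) (≤-trans Q≤Qs Qs≤P)

mainTheorem15 : ∀ (n : ℕ) (G : Adj n) → IsSimpleGraph G → ∀ (a b c d : Fin n) → IsTwoSwitch G a b c d → ∀ (p q : ℕ) → IsPathCoverNumber G p → IsPathCoverNumber (twoSwitch G a b c d) q → p ≤ suc q × q ≤ suc p
mainTheorem15 n G G-simple a b c d τ p q πG πH =
  pathCoverNumber-≤ (unswitch-covers G-simple τ) πH πG , pathCoverNumber-≤ (switch-covers G-simple τ) πG πH
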